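{- Let $W_n$ ($n\ge 3$) be the wheel of order $n+1$. Then $strc(W_3)=1$, and $strc(W_n)=\lceil n/3\rceil+1$ for $n\ge 4$.
   Context: All graphs are finite and simple. The wheel $W_n$ is obtained from the cycle $C_n$ by adding a new vertex adjacent to every vertex of $C_n$. A total-coloured path (vertices and edges coloured) is total-rainbow if its edges and internal vertices have pairwise distinct colours. $strc(G)$ is the minimum number of colours in a total-colouring of $G$ in which any two vertices $u,v$ are joined by a total-rainbow $u$–$v$ geodesic (a $u$–$v$ path of length $d(u,v)$). -}

module Defs where

open import Data.Nat using (ℕ; zero; suc; _+_; _≤_; _<_)
open import Data.Nat.DivMod using (_/_)
open import Data.Fin using (Fin; toℕ) renaming (zero to fzero; suc to fsuc)
open import Data.List using (List; []; _∷_; _++_; length)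
open import Data.List.Relation.Unary.Unique.Propositional using (Unique)
open import Data.Product using (Σ; _×_; _,_)
open import Data.Sum using (_⊎_)
open import Data.Empty using (⊥)
open import Data.Unit using (⊤)
open import Relation.Nullary using (¬_)
open import Relation.Binary.PropositionalEquality using (_≡_)

record Graph : Set₁ where
  field
    size    : ℕ
    Adj     : Fin size → Fin size → Set
    sym     : ∀ {u v} → Adj u v → Adj v u
    irrefl  : ∀ {u} → ¬ Adj u u

open Graph public

module _ (G : Graph) where
  private V = Fin (size G)

  data Walk : V → V → Set where
    [_]    : (v : V) → Walk v v
    _∷⟨_⟩_ : (u : V) {v w : V} → Adj G u v → Walk v w → Walk u w

  len : ∀ {u v} → Walk u v → ℕ
  len [ v ] = 0
  len (u ∷⟨ p ⟩ w) = suc (len w)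

  verts : ∀ {u v} → Walk u v → List V
  verts [ v ] = v ∷ []
  verts (u ∷⟨ p ⟩ w) = u ∷ verts w

  IsPath : ∀ {u v} → Walk u v → Set
  IsPath w = Unique (verts w)

  IsGeodesic : ∀ {u v} → Walk u v → Set
  IsGeodesic {u} {v} w = IsPath w × (∀ (w' : Walk u v) → IsPath w' → len w ≤ len w')

  allButLast : ∀ {u v} → Walk u v → List V
  allButLast [ v ] = []
  allButLast (u ∷⟨ p ⟩ w) = u ∷ allButLast w

  internal : ∀ {u v} → Walk u v → List V
  internal [ v ] = []
  internal (u ∷⟨ p ⟩ w) = allButLast w

  -- a total colouring with colours from Fin k (at most k colours).
  -- Edge colours are given by a symmetric function on vertex pairs; only its
  -- values on adjacent pairs are ever used.
  record TotalColouring (k : ℕ) : Set where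
    field
      vcol    : V → Fin k
      ecol    : V → V → Fin k
      ecolSym : ∀ u v → ecol u v ≡ ecol v u

  open TotalColouring public

  module _ {k : ℕ} (c : TotalColouring k) where
    edgeCols : ∀ {u v} → Walk u v → List (Fin k)
    edgeCols [ v ] = []
    edgeCols (_∷⟨_⟩_ u {v} p w) = ecol c u v ∷ edgeCols w

    TotalRainbow : ∀ {u v} → Walk u v → Set
    TotalRainbow w = Unique (edgeCols w ++ Data.List.map (vcol c) (internal w))

  STRConnecting : (k : ℕ) → TotalColouring k → Set
  STRConnecting k c = ∀ (u v : V) → Σ (Walk u v) λ w → IsGeodesic w × TotalRainbow c w

  HasSTRColouring : ℕ → Set
  HasSTRColouring k = Σ (TotalColouring k) (STRConnecting k)

  StrcIs : ℕ → Set
  StrcIs k = HasSTRColouring k × (∀ m → HasSTRColouring m → k ≤ m)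

CycStep : (n : ℕ) → Fin n → Fin n → Set
CycStep n i j = (suc (toℕ i) ≡ toℕ j) ⊎ (suc (toℕ i) ≡ n × toℕ j ≡ 0)

-- wheel W_n on Fin (suc n): fzero is the hub, fsuc i are the cycle vertices
WheelAdj : (n : ℕ) → Fin (suc n) → Fin (suc n) → Set
WheelAdj n fzero    fzero    = ⊥
WheelAdj n fzero    (fsuc j) = ⊤
WheelAdj n (fsuc i) fzero    = ⊤
WheelAdj n (fsuc i) (fsuc j) = CycStep n i j ⊎ CycStep n j i

-- n ≥ 3 needed for simplicity (no loops)
Wheel : (n : ℕ) → 3 ≤ n → Graph
Wheel n h = record { size = suc n ; Adj = WheelAdj n ; sym = symW ; irrefl = irr }
  where
  open import Data.Sum using (inj₁; inj₂)
  open import Data.Nat.Properties using (1+n≢n)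
  open import Relation.Binary.PropositionalEquality using (refl)
  symW : ∀ {u v} → WheelAdj n u v → WheelAdj n v u
  symW {fzero} {fsuc j} _ = _
  symW {fsuc i} {fzero} _ = _
  symW {fsuc i} {fsuc j} (inj₁ x) = inj₂ x
  symW {fsuc i} {fsuc j} (inj₂ x) = inj₁ x
  irr1 : ∀ {i} → ¬ CycStep n i i
  irr1 {i} (inj₁ e) = 1+n≢n e
  irr1 {i} (inj₂ (e , z)) with toℕ i
  irr1 {i} (inj₂ (e , refl)) | .0 = go h e
    where
    go : 3 ≤ n → 1 ≡ n → ⊥

    go (Data.Nat.s≤s (Data.Nat.s≤s (Data.Nat.s≤s _))) ()
  irr : ∀ {u} → ¬ WheelAdj n u u
  irr {fzero} ()
  irr {fsuc i} (inj₁ x) = irr1 x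
  irr {fsuc i} (inj₂ x) = irr1 x

⌈_/3⌉ : ℕ → ℕ
⌈ n /3⌉ = (n + 2) / 3

module Submission where

-- W₃ is K₄, so one colour suffices: every geodesic is a single edge.  For n ≥ 4,
-- distinct non-adjacent vertices are rim vertices at distance two, joined either
-- through the hub or along the rim, and a rainbow geodesic of length two needs
-- three colours (geodesicVia, distinct⇒3≤).
-- Upper bound (module UpperBound): colour every vertex 0, the spoke at rim vertex i
-- with 1 + ⌊i/3⌋ and a rim edge with larger end x with x mod 3.  Rim vertices of
-- different blocks {3b, 3b+1, 3b+2} meet through the hub, the ends of a block
-- through 3b+1.
-- Lower bound (module Counting): for n ≥ 7, rim vertices at cycle distance ≥ 3 must
-- meet through the hub, so their spokes differ in colour and avoid the hub colour.
-- Hence each of the p non-hub colours of a (1 + p)-colouring lies on at most three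
-- spokes, made precise by an injection of the rim into Fin p × Fin 3; so n ≤ 3p.
-- For 4 ≤ n ≤ 6 the three colours above already give ⌈n/3⌉ + 1 = 3.

open import Defs hiding (sym)
open import Data.Nat using (ℕ; zero; suc; _+_; _*_; _⊔_; _≤_; _<_; z≤n; s≤s; NonZero; >-nonZero; >-nonZero⁻¹)
open import Data.Nat.Properties
open import Data.Nat.DivMod using (_/_; _%_; m≡m%n+[m/n]*n; m%n<n; m<n*o⇒m/o<n; /-monoˡ-≤; [m+kn]%n≡m%n; m<n⇒m%n≡m; n%n≡0)
open import Data.Fin using (Fin; toℕ; fromℕ<; punchOut; combine) renaming (zero to fzero; suc to fsuc)
open import Data.Fin.Properties using (punchOut-injective; combine-injective; injective⇒≤; toℕ<n; toℕ-fromℕ<; toℕ-injective)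
  renaming (suc-injective to fsuc-injective; _≟_ to _≟ᶠ_)
open import Data.List using ([]; _∷_)
open import Data.List.Relation.Unary.Unique.Propositional using (Unique)
open import Data.List.Relation.Unary.All using ([]; _∷_)
open import Data.List.Relation.Unary.AllPairs using ([]; _∷_)
open import Data.Product using (Σ; _×_; _,_; proj₁; proj₂)
open import Data.Sum using (_⊎_; inj₁; inj₂)
open import Data.Empty using (⊥; ⊥-elim)
open import Data.Unit using (tt)
open import Function using (_∘_)
open import Relation.Nullary using (¬_; Dec; yes; no; does)
open import Relation.Nullary.Decidable using (_⊎-dec_; _×-dec_; dec-true; dec-false; from-yes)
open import Data.Bool using (Bool; true; false)
open import Relation.Binary.PropositionalEquality

⌈/3⌉-least : ∀ {n p} → n ≤ p * 3 → ⌈ n /3⌉ ≤ p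
⌈/3⌉-least {n} {p} n≤3p = ≤-pred (m<n*o⇒m/o<n (begin-strict
    n + 2      <⟨ +-monoʳ-< n (n<1+n 2) ⟩
    n + 3      ≤⟨ +-monoˡ-≤ 3 n≤3p ⟩
    p * 3 + 3  ≡⟨ +-comm (p * 3) 3 ⟩
    suc p * 3  ∎))
  where open ≤-Reasoning

⌈/3⌉-cover : ∀ n → n ≤ ⌈ n /3⌉ * 3
⌈/3⌉-cover n = +-cancelʳ-≤ 2 n (⌈ n /3⌉ * 3) (begin
    n + 2                              ≡⟨ m≡m%n+[m/n]*n (n + 2) 3 ⟩
    (n + 2) % 3 + ⌈ n /3⌉ * 3          ≤⟨ +-monoˡ-≤ (⌈ n /3⌉ * 3) (≤-pred (m%n<n (n + 2) 3)) ⟩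
    2 + ⌈ n /3⌉ * 3                    ≡⟨ +-comm 2 (⌈ n /3⌉ * 3) ⟩
    ⌈ n /3⌉ * 3 + 2                    ∎)
  where open ≤-Reasoning

⌈/3⌉≥2 : ∀ {n} → 4 ≤ n → 2 ≤ ⌈ n /3⌉
⌈/3⌉≥2 4≤n = /-monoˡ-≤ 3 (+-monoˡ-≤ 2 4≤n)

residues : ∀ {r s} → r < 3 → s < 3 → r ≢ s → suc r ≢ s → suc s ≢ r → (r ≡ 0 × s ≡ 2) ⊎ (r ≡ 2 × s ≡ 0)
residues {0} {0} _ _ r≢s _ _ = ⊥-elim (r≢s refl)
residues {0} {1} _ _ _ r+1≢s _ = ⊥-elim (r+1≢s refl)
residues {0} {2} _ _ _ _ _ = inj₁ (refl , refl)
residues {1} {0} _ _ _ _ s+1≢r = ⊥-elim (s+1≢r refl)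
residues {1} {1} _ _ r≢s _ _ = ⊥-elim (r≢s refl)
residues {1} {2} _ _ _ r+1≢s _ = ⊥-elim (r+1≢s refl)
residues {2} {0} _ _ _ _ _ = inj₂ (refl , refl)
residues {2} {1} _ _ _ _ s+1≢r = ⊥-elim (s+1≢r refl)
residues {2} {2} _ _ r≢s _ _ = ⊥-elim (r≢s refl)
residues {suc (suc (suc _))} (s≤s (s≤s (s≤s ()))) _ _ _ _
residues {_} {suc (suc (suc _))} _ (s≤s (s≤s (s≤s ()))) _ _ _

sameBlock : ∀ {x y} → x / 3 ≡ y / 3 → x ≢ y → suc x ≢ y → suc y ≢ x
          → (x ≡ (x / 3) * 3 × y ≡ 2 + (x / 3) * 3) ⊎ (x ≡ 2 + (x / 3) * 3 × y ≡ (x / 3) * 3)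
sameBlock {x} {y} x/3≡y/3 x≢y x+1≢y y+1≢x =
  ends (residues (m%n<n x 3) (m%n<n y 3)
                 (x≢y ∘ relate x≡ y≡) (x+1≢y ∘ relate (cong suc x≡) y≡) (y+1≢x ∘ relate (cong suc y≡) x≡))
  where
  q : ℕ
  q = x / 3
  x≡ : x ≡ x % 3 + q * 3
  x≡ = m≡m%n+[m/n]*n x 3
  y≡ : y ≡ y % 3 + q * 3
  y≡ = trans (m≡m%n+[m/n]*n y 3) (cong (λ p → y % 3 + p * 3) (sym x/3≡y/3))
  relate : ∀ {a b c d} → a ≡ c + q * 3 → b ≡ d + q * 3 → c ≡ d → a ≡ b
  relate a≡ b≡ c≡d = trans a≡ (trans (cong (_+ q * 3) c≡d) (sym b≡))
  ends : (x % 3 ≡ 0 × y % 3 ≡ 2) ⊎ (x % 3 ≡ 2 × y % 3 ≡ 0)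
       → (x ≡ q * 3 × y ≡ 2 + q * 3) ⊎ (x ≡ 2 + q * 3 × y ≡ q * 3)
  ends (inj₁ (r≡0 , s≡2)) = inj₁ (trans x≡ (cong (_+ q * 3) r≡0) , trans y≡ (cong (_+ q * 3) s≡2))
  ends (inj₂ (r≡2 , s≡0)) = inj₂ (trans x≡ (cong (_+ q * 3) r≡2) , trans y≡ (cong (_+ q * 3) s≡0))

distinct⇒2≤ : ∀ {k} {a b : Fin k} → a ≢ b → 2 ≤ k
distinct⇒2≤ {suc zero} {fzero} {fzero} a≢b = ⊥-elim (a≢b refl)
distinct⇒2≤ {suc (suc _)} _ = s≤s (s≤s z≤n)

distinctIndices : ∀ {k} {a b d : Fin k} {x y z} → toℕ a ≡ x → toℕ b ≡ y → toℕ d ≡ z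
                → x ≢ y → x ≢ z → y ≢ z → Unique (a ∷ b ∷ d ∷ [])
distinctIndices refl refl refl x≢y x≢z y≢z =
  ((x≢y ∘ cong toℕ) ∷ (x≢z ∘ cong toℕ) ∷ []) ∷ ((y≢z ∘ cong toℕ) ∷ []) ∷ [] ∷ []

distinct⇒3≤ : ∀ {k} {a b d : Fin k} → Unique (a ∷ b ∷ d ∷ []) → 3 ≤ k
distinct⇒3≤ {suc k} ((a≢b ∷ a≢d ∷ []) ∷ (b≢d ∷ []) ∷ [] ∷ []) =
  s≤s (distinct⇒2≤ (b≢d ∘ punchOut-injective a≢b a≢d))

module _ (G : Graph) where
  private
    V : Set
    V = Fin (size G)

  distinct⇒1≤len : ∀ {u v} → u ≢ v → (w : Walk G u v) → 1 ≤ len G w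
  distinct⇒1≤len u≢v [ _ ] = ⊥-elim (u≢v refl)
  distinct⇒1≤len u≢v (_ ∷⟨ _ ⟩ _) = s≤s z≤n

  nonAdjacent⇒2≤len : ∀ {u v} → u ≢ v → ¬ Adj G u v → (w : Walk G u v) → 2 ≤ len G w
  nonAdjacent⇒2≤len u≢v _ [ _ ] = ⊥-elim (u≢v refl)
  nonAdjacent⇒2≤len _ ¬uv (_ ∷⟨ uv ⟩ [ _ ]) = ⊥-elim (¬uv uv)
  nonAdjacent⇒2≤len _ _ (_ ∷⟨ _ ⟩ (_ ∷⟨ _ ⟩ _)) = s≤s (s≤s z≤n)

  -- u – x – v is a path as soon as its ends differ (loops are excluded by simplicity).
  twoStepPath : ∀ {u x v} (ux : Adj G u x) (xv : Adj G x v) → u ≢ v → IsPath G (u ∷⟨ ux ⟩ (x ∷⟨ xv ⟩ [ v ]))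
  twoStepPath ux xv u≢v = ((λ { refl → irrefl G ux }) ∷ u≢v ∷ []) ∷ ((λ { refl → irrefl G xv }) ∷ []) ∷ [] ∷ []

  module _ {k : ℕ} (c : TotalColouring G k) where

    RainbowGeodesic : V → V → Set
    RainbowGeodesic u v = Σ (Walk G u v) λ w → IsGeodesic G w × TotalRainbow G c w

    RainbowVia : V → V → V → Set
    RainbowVia u x v = Adj G u x × Adj G x v × Unique (ecol c u x ∷ ecol c x v ∷ vcol c x ∷ [])

    trivialGeodesic : ∀ u → RainbowGeodesic u u
    trivialGeodesic u = [ u ] , ([] ∷ [] , λ _ _ → z≤n) , []

    edgeGeodesic : ∀ {u v} → Adj G u v → RainbowGeodesic u v
    edgeGeodesic {u} {v} uv = _ ∷⟨ uv ⟩ [ _ ] , ((u≢v ∷ []) ∷ [] ∷ [] , λ w _ → distinct⇒1≤len u≢v w) , [] ∷ []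
      where
      u≢v : u ≢ v
      u≢v refl = irrefl G uv

    viaGeodesic : ∀ {u x v} → u ≢ v → ¬ Adj G u v → RainbowVia u x v → RainbowGeodesic u v
    viaGeodesic u≢v ¬uv (ux , xv , rainbow) =
      _ ∷⟨ ux ⟩ (_ ∷⟨ xv ⟩ [ _ ]) , (twoStepPath ux xv u≢v , λ w _ → nonAdjacent⇒2≤len u≢v ¬uv w) , rainbow

    geodesicVia : ∀ {u y v} → u ≢ v → ¬ Adj G u v → Adj G u y → Adj G y v → RainbowGeodesic u v
                → Σ V λ x → RainbowVia u x v
    geodesicVia {u} {y} {v} u≢v ¬uv uy yv (w , (_ , shortest) , rainbow) =
      middle w (shortest (u ∷⟨ uy ⟩ (y ∷⟨ yv ⟩ [ v ])) (twoStepPath uy yv u≢v)) rainbow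
      where
      middle : (w : Walk G u v) → len G w ≤ 2 → TotalRainbow G c w → Σ V λ x → RainbowVia u x v
      middle [ _ ] _ _ = ⊥-elim (u≢v refl)
      middle (_ ∷⟨ uv ⟩ [ _ ]) _ _ = ⊥-elim (¬uv uv)
      middle (_ ∷⟨ ux ⟩ (x ∷⟨ xv ⟩ [ _ ])) _ rainbow = x , ux , xv , rainbow
      middle (_ ∷⟨ _ ⟩ (_ ∷⟨ _ ⟩ (_ ∷⟨ _ ⟩ _))) (s≤s (s≤s ())) _

cycStep? : ∀ n (i j : Fin n) → Dec (CycStep n i j)
cycStep? n i j = (suc (toℕ i) ≟ toℕ j) ⊎-dec ((suc (toℕ i) ≟ n) ×-dec (toℕ j ≟ 0))

rimAdjacent? : ∀ n (i j : Fin n) → Dec (WheelAdj n (fsuc i) (fsuc j))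
rimAdjacent? n i j = cycStep? n i j ⊎-dec cycStep? n j i

module UpperBound (n : ℕ) (h : 3 ≤ n) (4≤n : 4 ≤ n) where
  private
    q : ℕ
    q = ⌈ n /3⌉
    V : Set
    V = Fin (suc n)

  block : Fin n → Fin q
  block i = fromℕ< (m<n*o⇒m/o<n (<-≤-trans (toℕ<n i) (⌈/3⌉-cover n)))

  rimColour : ℕ → Fin (suc q)
  rimColour x = fromℕ< (<-≤-trans (m%n<n x 3) (s≤s (⌈/3⌉≥2 4≤n)))

  edgeColour : V → V → Fin (suc q)
  edgeColour fzero    fzero    = fzero
  edgeColour fzero    (fsuc j) = fsuc (block j)
  edgeColour (fsuc i) fzero    = fsuc (block i)
  edgeColour (fsuc i) (fsuc j) = rimColour (toℕ i ⊔ toℕ j)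

  edgeColour-sym : ∀ u v → edgeColour u v ≡ edgeColour v u
  edgeColour-sym fzero    fzero    = refl
  edgeColour-sym fzero    (fsuc j) = refl
  edgeColour-sym (fsuc i) fzero    = refl
  edgeColour-sym (fsuc i) (fsuc j) = cong rimColour (⊔-comm (toℕ i) (toℕ j))

  colouring : TotalColouring (Wheel n h) (suc q)
  colouring = record { vcol = λ _ → fzero ; ecol = edgeColour ; ecolSym = edgeColour-sym }

  Geodesic : V → V → Set
  Geodesic = RainbowGeodesic (Wheel n h) colouring

  Via : V → V → V → Set
  Via = RainbowVia (Wheel n h) colouring

  hubRoute : ∀ i j → toℕ i / 3 ≢ toℕ j / 3 → Via (fsuc i) fzero (fsuc j)
  hubRoute i j different =
    tt , tt , distinctIndices (cong suc (toℕ-fromℕ< _)) (cong suc (toℕ-fromℕ< _)) refl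
                              (different ∘ suc-injective) (λ ()) (λ ())

  stepColour : ∀ {x y} → suc x ≡ y → toℕ (rimColour (x ⊔ y)) ≡ y % 3 × toℕ (rimColour (y ⊔ x)) ≡ y % 3
  stepColour {x} refl = trans (toℕ-fromℕ< _) (cong (_% 3) (m≤n⇒m⊔n≡n (n≤1+n x)))
                      , trans (toℕ-fromℕ< _) (cong (_% 3) (m≥n⇒m⊔n≡m (n≤1+n x)))

  -- The ends 3b and 3b+2 of a block are joined along the rim through 3b+1:
  -- the two rim edges have colours 1 and 2, the middle vertex colour 0.
  rimRoute : ∀ {a z} b → toℕ a ≡ b * 3 → toℕ z ≡ 2 + b * 3
           → Σ (Fin n) λ m → Via (fsuc a) (fsuc m) (fsuc z) × Via (fsuc z) (fsuc m) (fsuc a)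
  rimRoute {a} {z} b a≡ z≡ =
    m , (inj₁ (inj₁ a→m) , inj₁ (inj₁ m→z) , distinctIndices am mz refl (λ ()) (λ ()) (λ ()))
      , (inj₂ (inj₁ m→z) , inj₂ (inj₁ a→m) , distinctIndices zm ma refl (λ ()) (λ ()) (λ ()))
    where
    m : Fin n
    m = fromℕ< (<-trans (n<1+n (1 + b * 3)) (subst (_< n) z≡ (toℕ<n z)))
    m≡ : toℕ m ≡ 1 + b * 3
    m≡ = toℕ-fromℕ< _
    a→m : suc (toℕ a) ≡ toℕ m
    a→m = trans (cong suc a≡) (sym m≡)
    m→z : suc (toℕ m) ≡ toℕ z
    m→z = trans (cong suc m≡) (sym z≡)
    m%3 : toℕ m % 3 ≡ 1
    m%3 = trans (cong (_% 3) m≡) ([m+kn]%n≡m%n 1 b 3)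
    z%3 : toℕ z % 3 ≡ 2
    z%3 = trans (cong (_% 3) z≡) ([m+kn]%n≡m%n 2 b 3)
    am : toℕ (edgeColour (fsuc a) (fsuc m)) ≡ 1
    am = trans (proj₁ (stepColour a→m)) m%3
    ma : toℕ (edgeColour (fsuc m) (fsuc a)) ≡ 1
    ma = trans (proj₂ (stepColour a→m)) m%3
    mz : toℕ (edgeColour (fsuc m) (fsuc z)) ≡ 2
    mz = trans (proj₁ (stepColour m→z)) z%3
    zm : toℕ (edgeColour (fsuc z) (fsuc m)) ≡ 2
    zm = trans (proj₂ (stepColour m→z)) z%3

  rimGeodesic : ∀ i j → i ≢ j → ¬ WheelAdj n (fsuc i) (fsuc j) → Geodesic (fsuc i) (fsuc j)
  rimGeodesic i j i≢j ¬ij with toℕ i / 3 ≟ toℕ j / 3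
  ... | no different = viaGeodesic _ colouring {x = fzero} (i≢j ∘ fsuc-injective) ¬ij (hubRoute i j different)
  ... | yes same with sameBlock same (i≢j ∘ toℕ-injective) (¬ij ∘ inj₁ ∘ inj₁) (¬ij ∘ inj₂ ∘ inj₁)
  ...   | inj₁ (i≡ , j≡) = viaGeodesic _ colouring (i≢j ∘ fsuc-injective) ¬ij (proj₁ (proj₂ (rimRoute (toℕ i / 3) i≡ j≡)))
  ...   | inj₂ (i≡ , j≡) = viaGeodesic _ colouring (i≢j ∘ fsuc-injective) ¬ij (proj₂ (proj₂ (rimRoute (toℕ i / 3) j≡ i≡)))

  connecting : STRConnecting (Wheel n h) (suc q) colouring
  connecting fzero    fzero    = trivialGeodesic _ colouring fzero
  connecting fzero    (fsuc j) = edgeGeodesic _ colouring tt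
  connecting (fsuc i) fzero    = edgeGeodesic _ colouring tt
  connecting (fsuc i) (fsuc j) with i ≟ᶠ j | rimAdjacent? n i j
  ... | yes refl | _      = trivialGeodesic _ colouring (fsuc i)
  ... | no i≢j   | yes ij = edgeGeodesic _ colouring ij
  ... | no i≢j   | no ¬ij = rimGeodesic i j i≢j ¬ij

  upperBound : HasSTRColouring (Wheel n h) (⌈ n /3⌉ + 1)
  upperBound = subst (HasSTRColouring (Wheel n h)) (+-comm 1 q) (colouring , connecting)

module Cycle (n : ℕ) .{{_ : NonZero n}} where

  next : Fin n → Fin n
  next i = fromℕ< (m%n<n (suc (toℕ i)) n)

  step-next : ∀ i → CycStep n i (next i)
  step-next i with m≤n⇒m<n∨m≡n (toℕ<n i)
  ... | inj₁ i+1<n = inj₁ (sym (trans (toℕ-fromℕ< _) (m<n⇒m%n≡m i+1<n)))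
  ... | inj₂ i+1≡n = inj₂ (i+1≡n , trans (toℕ-fromℕ< _) (trans (cong (_% n) i+1≡n) (n%n≡0 n)))

  step-functional : ∀ {i j j′} → CycStep n i j → CycStep n i j′ → j ≡ j′
  step-functional (inj₁ i+1≡j) (inj₁ i+1≡j′) = toℕ-injective (trans (sym i+1≡j) i+1≡j′)
  step-functional {j = j} (inj₁ i+1≡j) (inj₂ (i+1≡n , _)) = ⊥-elim (<⇒≢ (toℕ<n j) (trans (sym i+1≡j) i+1≡n))
  step-functional {j′ = j′} (inj₂ (i+1≡n , _)) (inj₁ i+1≡j′) = ⊥-elim (<⇒≢ (toℕ<n j′) (trans (sym i+1≡j′) i+1≡n))
  step-functional (inj₂ (_ , j≡0)) (inj₂ (_ , j′≡0)) = toℕ-injective (trans j≡0 (sym j′≡0))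

  step-injective : ∀ {i i′ j} → CycStep n i j → CycStep n i′ j → i ≡ i′
  step-injective (inj₁ i+1≡j) (inj₁ i′+1≡j) = toℕ-injective (suc-injective (trans i+1≡j (sym i′+1≡j)))
  step-injective (inj₁ i+1≡j) (inj₂ (_ , j≡0)) = ⊥-elim (0≢1+n (trans (sym j≡0) (sym i+1≡j)))
  step-injective (inj₂ (_ , j≡0)) (inj₁ i′+1≡j) = ⊥-elim (0≢1+n (trans (sym j≡0) (sym i′+1≡j)))
  step-injective (inj₂ (i+1≡n , _)) (inj₂ (i′+1≡n , _)) = toℕ-injective (suc-injective (trans i+1≡n (sym i′+1≡n)))

  next-injective : ∀ {i j} → next i ≡ next j → i ≡ j
  next-injective {i} {j} eq = step-injective (step-next i) (subst (CycStep n j) (sym eq) (step-next j))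

  adjacent⇒next : ∀ {i j} → WheelAdj n (fsuc i) (fsuc j) → j ≡ next i ⊎ i ≡ next j
  adjacent⇒next {i} (inj₁ i→j) = inj₁ (step-functional i→j (step-next i))
  adjacent⇒next {_} {j} (inj₂ j→i) = inj₂ (step-functional j→i (step-next j))

  shift : ℕ → Fin n → Fin n
  shift zero    i = i
  shift (suc t) i = next (shift t i)

  suc-mod : ∀ m → suc (m % n) % n ≡ suc m % n
  suc-mod m = sym (begin
    suc m % n                         ≡⟨ cong (λ z → suc z % n) (m≡m%n+[m/n]*n m n) ⟩
    (suc (m % n) + (m / n) * n) % n   ≡⟨ [m+kn]%n≡m%n (suc (m % n)) (m / n) n ⟩
    suc (m % n) % n                   ∎)
    where open ≡-Reasoning

  toℕ-shift : ∀ t i → toℕ (shift t i) ≡ (toℕ i + t) % n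
  toℕ-shift zero    i = sym (trans (cong (_% n) (+-identityʳ (toℕ i))) (m<n⇒m%n≡m (toℕ<n i)))
  toℕ-shift (suc t) i = begin
    toℕ (next (shift t i))         ≡⟨ toℕ-fromℕ< _ ⟩
    suc (toℕ (shift t i)) % n      ≡⟨ cong (λ z → suc z % n) (toℕ-shift t i) ⟩
    suc ((toℕ i + t) % n) % n      ≡⟨ suc-mod (toℕ i + t) ⟩
    suc (toℕ i + t) % n            ≡⟨ cong (_% n) (sym (+-suc (toℕ i) t)) ⟩
    (toℕ i + suc t) % n            ∎
    where open ≡-Reasoning

  -- x + d ≡ x mod n forces n ∣ d, impossible for 0 < d < n
  noFix : ∀ x {d} → 0 < d → d < n → (x + d) % n ≢ x
  noFix x {d} 0<d d<n fixed = multiple ((x + d) / n) d≡kn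
    where
    d≡kn : d ≡ ((x + d) / n) * n
    d≡kn = +-cancelˡ-≡ x d _ (trans (m≡m%n+[m/n]*n (x + d) n) (cong (_+ ((x + d) / n) * n) fixed))
    multiple : ∀ k → d ≡ k * n → ⊥
    multiple zero    d≡0 = <-irrefl (sym d≡0) 0<d
    multiple (suc k) d≡n+kn = <-irrefl refl (<-≤-trans d<n (subst (n ≤_) (sym d≡n+kn) (m≤m+n n (k * n))))

  shift-noFix : ∀ {d} i → 0 < d → d < n → shift d i ≢ i
  shift-noFix {d} i 0<d d<n fixed = noFix (toℕ i) 0<d d<n (trans (sym (toℕ-shift d i)) (cong toℕ fixed))

module Constraints (n : ℕ) (h : 3 ≤ n) {k : ℕ} (c : TotalColouring (Wheel n h) k)
                   (connected : STRConnecting (Wheel n h) k c) where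

  -- Distinct non-adjacent rim vertices have the hub as a common neighbour, so a
  -- rainbow geodesic between them has a rainbow middle vertex.
  rimMiddle : ∀ i j → i ≢ j → ¬ WheelAdj n (fsuc i) (fsuc j)
            → Σ (Fin (suc n)) λ x → RainbowVia (Wheel n h) c (fsuc i) x (fsuc j)
  rimMiddle i j i≢j ¬ij =
    geodesicVia (Wheel n h) c {y = fzero} (i≢j ∘ fsuc-injective) ¬ij tt tt (connected (fsuc i) (fsuc j))

  nonAdjacent⇒3≤ : ∀ i j → i ≢ j → ¬ WheelAdj n (fsuc i) (fsuc j) → 3 ≤ k
  nonAdjacent⇒3≤ i j i≢j ¬ij with rimMiddle i j i≢j ¬ij
  ... | _ , _ , _ , rainbow = distinct⇒3≤ rainbow

-- For n ≥ 4 the rim vertices 0 and 2 are non-adjacent, so three colours are needed.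
atLeastThree : ∀ {n h k} → 4 ≤ n → HasSTRColouring (Wheel n h) k → 3 ≤ k
atLeastThree {n} {h} (s≤s (s≤s (s≤s (s≤s _)))) (c , connected) =
  Constraints.nonAdjacent⇒3≤ n h c connected fzero (fsuc (fsuc fzero)) (λ ())
    λ { (inj₁ (inj₁ ())) ; (inj₁ (inj₂ (() , _))) ; (inj₂ (inj₁ ())) ; (inj₂ (inj₂ (() , _))) }

count : Bool → Bool → Fin 3
count false false = fzero
count true  false = fsuc fzero
count false true  = fsuc fzero
count true  true  = fsuc (fsuc fzero)

count-shift : ∀ b → count true b ≢ count b false
count-shift false ()
count-shift true  ()

count-second : ∀ b → count b true ≢ count false false
count-second false ()
count-second true  ()

module Counting (n : ℕ) (h : 3 ≤ n) (7≤n : 7 ≤ n) {p : ℕ} (c : TotalColouring (Wheel n h) (suc p))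
                (connected : STRConnecting (Wheel n h) (suc p) c) where
  private instance
    n≢0 : NonZero n
    n≢0 = >-nonZero (<-≤-trans (s≤s z≤n) 7≤n)

  open Cycle n
  open Constraints n h c connected

  H : Fin (suc p)
  H = vcol c fzero

  S : Fin n → Fin (suc p)
  S i = ecol c fzero (fsuc i)

  Close : Fin n → Fin n → Set
  Close i j = j ≡ next i ⊎ j ≡ next (next i)

  -- Rim vertices that are not close must be joined through the hub.
  distantSpokes : ∀ i j → i ≢ j → ¬ Close i j → ¬ Close j i → S i ≢ S j × H ≢ S i
  distantSpokes i j i≢j ¬ij ¬ji with rimMiddle i j i≢j nonAdjacent
    where
    nonAdjacent : ¬ WheelAdj n (fsuc i) (fsuc j)
    nonAdjacent adj with adjacent⇒next adj
    ... | inj₁ j≡i+1 = ¬ij (inj₁ j≡i+1)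
    ... | inj₂ i≡j+1 = ¬ji (inj₁ i≡j+1)
  ... | fzero , _ , _ , (si≢sj ∷ si≢h ∷ []) ∷ _ =
    si≢sj ∘ trans (ecolSym c (fsuc i) fzero) , si≢h ∘ trans (ecolSym c (fsuc i) fzero) ∘ sym
  ... | fsuc m , im , mj , _ with adjacent⇒next im | adjacent⇒next mj
  ...   | inj₁ refl | inj₁ refl = ⊥-elim (¬ij (inj₂ refl))
  ...   | inj₁ refl | inj₂ i+1≡j+1 = ⊥-elim (i≢j (next-injective i+1≡j+1))
  ...   | inj₂ refl | inj₁ j≡m+1 = ⊥-elim (i≢j (sym j≡m+1))
  ...   | inj₂ refl | inj₂ refl = ⊥-elim (¬ji (inj₂ refl))

  farAhead : ∀ e i → 5 + e < n → let j = shift (3 + e) i in i ≢ j × ¬ Close i j × ¬ Close j i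
  farAhead e i 5+e<n =
      (λ i≡j → offset 3 (from-yes (3 ≤? 5)) (sym i≡j))
    , (λ { (inj₁ j≡i+1) → offset 2 (from-yes (2 ≤? 5)) (next-injective j≡i+1)
         ; (inj₂ j≡i+2) → offset 1 (from-yes (1 ≤? 5)) (next-injective (next-injective j≡i+2)) })
    , (λ { (inj₁ i≡j+1) → offset 4 (from-yes (4 ≤? 5)) (sym i≡j+1)
         ; (inj₂ i≡j+2) → offset 5 (from-yes (5 ≤? 5)) (sym i≡j+2) })
    where
    offset : ∀ d .{{_ : NonZero d}} → d ≤ 5 → shift (d + e) i ≢ i
    offset d d≤5 = shift-noFix i (<-≤-trans (>-nonZero⁻¹ d) (m≤m+n d e)) (≤-<-trans (+-monoˡ-≤ e d≤5) 5+e<n)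

  spokeGap : ∀ e i → 5 + e < n → S i ≢ S (shift (3 + e) i) × H ≢ S i
  spokeGap e i 5+e<n with farAhead e i 5+e<n
  ... | i≢j , ¬ij , ¬ji = distantSpokes i _ i≢j ¬ij ¬ji

  6<n : 6 < n
  6<n = 7≤n

  5<n : 5 < n
  5<n = <-trans (n<1+n 5) 6<n

  hubColour≢spoke : ∀ i → H ≢ S i
  hubColour≢spoke i = proj₂ (spokeGap 0 i 5<n)

  repeats : ℕ → Fin n → Bool
  repeats t i = does (S (shift t i) ≟ᶠ S i)

  signature : Fin n → Fin 3
  signature i = count (repeats 1 i) (repeats 2 i)

  repeats-recolour : ∀ t {i j} → S j ≡ S i → does (S (shift t i) ≟ᶠ S j) ≡ does (S (shift t i) ≟ᶠ S i)
  repeats-recolour t {i} Sj≡Si = cong (λ s → does (S (shift t i) ≟ᶠ s)) Sj≡Si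

  noRepeat : ∀ e i → 5 + e < n → does (S (shift (3 + e) i) ≟ᶠ S i) ≡ false
  noRepeat e i 5+e<n = dec-false (S (shift (3 + e) i) ≟ᶠ S i) (proj₁ (spokeGap e i 5+e<n) ∘ sym)

  signature-next : ∀ i → S (next i) ≡ S i → signature i ≢ signature (next i)
  signature-next i same eq = count-shift (repeats 2 i) (begin
    count true (repeats 2 i)              ≡⟨ cong (λ b → count b (repeats 2 i)) (sym (dec-true (S (next i) ≟ᶠ S i) same)) ⟩
    signature i                           ≡⟨ eq ⟩
    signature (next i)                    ≡⟨ cong₂ count (repeats-recolour 2 same) (trans (repeats-recolour 3 same) (noRepeat 0 i 5<n)) ⟩
    count (repeats 2 i) false             ∎)
    where open ≡-Reasoning

  signature-next² : ∀ i → S (next (next i)) ≡ S i → signature i ≢ signature (next (next i))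
  signature-next² i same eq = count-second (repeats 1 i) (begin
    count (repeats 1 i) true              ≡⟨ cong (count (repeats 1 i)) (sym (dec-true (S (next (next i)) ≟ᶠ S i) same)) ⟩
    signature i                           ≡⟨ eq ⟩
    signature (next (next i))             ≡⟨ cong₂ count (trans (repeats-recolour 3 same) (noRepeat 0 i 5<n))
                                                         (trans (repeats-recolour 4 same) (noRepeat 1 i 6<n)) ⟩
    count false false                     ∎)
    where open ≡-Reasoning

  closeRepeat : ∀ {i j} → Close i j → S i ≡ S j → signature i ≢ signature j
  closeRepeat (inj₁ refl) Si≡Sj = signature-next _ (sym Si≡Sj)
  closeRepeat (inj₂ refl) Si≡Sj = signature-next² _ (sym Si≡Sj)

  close? : ∀ i j → Dec (Close i j)
  close? i j = (j ≟ᶠ next i) ⊎-dec (j ≟ᶠ next (next i))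

  -- a rim vertex is determined by its spoke colour (other than H) and its signature
  code : Fin n → Fin (p * 3)
  code i = combine (punchOut (hubColour≢spoke i)) (signature i)

  code-injective : ∀ {i j} → code i ≡ code j → i ≡ j
  code-injective {i} {j} eq = decide (i ≟ᶠ j) (close? i j) (close? j i)
    where
    parts : punchOut (hubColour≢spoke i) ≡ punchOut (hubColour≢spoke j) × signature i ≡ signature j
    parts = combine-injective (punchOut (hubColour≢spoke i)) (signature i)
                              (punchOut (hubColour≢spoke j)) (signature j) eq
    sameColour : S i ≡ S j
    sameColour = punchOut-injective (hubColour≢spoke i) (hubColour≢spoke j) (proj₁ parts)
    sameSignature : signature i ≡ signature j
    sameSignature = proj₂ parts
    decide : Dec (i ≡ j) → Dec (Close i j) → Dec (Close j i) → i ≡ j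
    decide (yes i≡j) _        _        = i≡j
    decide (no _)    (yes ij) _        = ⊥-elim (closeRepeat ij sameColour sameSignature)
    decide (no _)    (no _)   (yes ji) = ⊥-elim (closeRepeat ji (sym sameColour) (sym sameSignature))
    decide (no i≢j)  (no ¬ij) (no ¬ji) = ⊥-elim (proj₁ (distantSpokes i j i≢j ¬ij ¬ji) sameColour)

  rimBound : n ≤ p * 3
  rimBound = injective⇒≤ code-injective

paletteBound : ∀ {n h p} → 4 ≤ n → HasSTRColouring (Wheel n h) (suc p) → n ≤ p * 3
paletteBound {n} {h} {p} 4≤n (c , connected) with 7 ≤? n
... | yes 7≤n = Counting.rimBound n h 7≤n c connected
... | no  n<7 = ≤-trans (≤-pred (≰⇒> n<7)) (*-monoˡ-≤ 3 (≤-pred (atLeastThree {h = h} 4≤n (c , connected))))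

lowerBound : ∀ {n h m} → 4 ≤ n → HasSTRColouring (Wheel n h) m → ⌈ n /3⌉ + 1 ≤ m
lowerBound {m = zero}  _   (c , _) with () ← vcol c fzero
lowerBound {n} {h} {suc p} 4≤n colouring =
  subst (_≤ suc p) (+-comm 1 ⌈ n /3⌉) (s≤s (⌈/3⌉-least (paletteBound {h = h} 4≤n colouring)))

W₃-complete : ∀ (u v : Fin 4) → u ≢ v → WheelAdj 3 u v
W₃-complete fzero    fzero    u≢v = ⊥-elim (u≢v refl)
W₃-complete fzero    (fsuc _) _   = tt
W₃-complete (fsuc _) fzero    _   = tt
W₃-complete (fsuc i) (fsuc j) u≢v = rim i j (u≢v ∘ cong fsuc)
  where
  rim : ∀ (i j : Fin 3) → i ≢ j → WheelAdj 3 (fsuc i) (fsuc j)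
  rim fzero fzero i≢j = ⊥-elim (i≢j refl)
  rim fzero (fsuc fzero) _ = inj₁ (inj₁ refl)
  rim fzero (fsuc (fsuc fzero)) _ = inj₂ (inj₂ (refl , refl))
  rim (fsuc fzero) fzero _ = inj₂ (inj₁ refl)
  rim (fsuc fzero) (fsuc fzero) i≢j = ⊥-elim (i≢j refl)
  rim (fsuc fzero) (fsuc (fsuc fzero)) _ = inj₁ (inj₁ refl)
  rim (fsuc (fsuc fzero)) fzero _ = inj₁ (inj₂ (refl , refl))
  rim (fsuc (fsuc fzero)) (fsuc fzero) _ = inj₂ (inj₁ refl)
  rim (fsuc (fsuc fzero)) (fsuc (fsuc fzero)) i≢j = ⊥-elim (i≢j refl)

strc-W₃ : ∀ h → StrcIs (Wheel 3 h) 1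
strc-W₃ h = (monochrome , connecting) , λ { m (c , _) → nonEmpty (vcol c fzero) }
  where
  monochrome : TotalColouring (Wheel 3 h) 1
  monochrome = record { vcol = λ _ → fzero ; ecol = λ _ _ → fzero ; ecolSym = λ _ _ → refl }
  connecting : STRConnecting (Wheel 3 h) 1 monochrome
  connecting u v with u ≟ᶠ v
  ... | yes refl = trivialGeodesic _ monochrome u
  ... | no u≢v   = edgeGeodesic _ monochrome (W₃-complete u v u≢v)
  nonEmpty : ∀ {m} → Fin m → 1 ≤ m
  nonEmpty fzero    = s≤s z≤n
  nonEmpty (fsuc _) = s≤s z≤n

theorem3p5 : (StrcIs (Wheel 3 (Data.Nat.s≤s (Data.Nat.s≤s (Data.Nat.s≤s Data.Nat.z≤n)))) 1)
    × (∀ (n : ℕ) (h : 3 ≤ n) → 4 ≤ n → StrcIs (Wheel n h) (⌈ n /3⌉ + 1))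
theorem3p5 = strc-W₃ (s≤s (s≤s (s≤s z≤n))) , λ n h 4≤n → UpperBound.upperBound n h 4≤n , λ _ → lowerBound {h = h} 4≤n
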